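{- Let $v_{n,k}$ be the number of dispersed Dyck paths of length $n$ that are either empty or whose last step is a flat step $H$, and which have exactly $k$ valleys on level 0; let $f_0(z,t)=\sum_{n,k}v_{n,k}z^nt^k$. Let $r_2=\frac{1-\sqrt{1-4z^2}}{2z}$ and \[ f_1=\frac{z}{1-z-z^2t+z^3(t-1)+z(z-1)r_2}. \] Then $f_0=\dfrac{1+z^2f_1}{1-z}$. In particular \[ f_0(z,0)=\frac{2}{2-3z+z\sqrt{1-4z^2}},\qquad \frac{\partial f_0}{\partial t}\Big|_{t=1}=\frac{1-3z^2+(z^2-1)\sqrt{1-4z^2}}{2z(1-2z)}=z^5+2z^6+7z^7+14z^8+\cdots. \]
   Context: A dispersed Dyck path of length $n$ is a sequence of $n$ steps, each an up-step $U=(1,1)$, a down-step $D=(1,-1)$, or a flat step $H=(1,0)$, starting at $(0,0)$, ending on the $x$-axis, never going below the $x$-axis, such that flat steps occur only on the $x$-axis. A valley on level 0 is a pair of consecutive steps $DU$ in which the $D$ step ends on the $x$-axis. -}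

module Defs where

open import Data.Bool using (Bool; true; false; _∧_; if_then_else_)
open import Data.Nat using (ℕ; zero; suc; _∸_; _≡ᵇ_)
open import Data.List using (List; []; _∷_; length; filterᵇ; concatMap; map)
open import Data.Integer using (ℤ; +_; _+_; _-_; _*_)
open import Relation.Binary.PropositionalEquality using (_≡_)

data Step : Set where
  U D H : Step

words : ℕ → List (List Step)
words zero    = [] ∷ []
words (suc n) = concatMap (λ w → (U ∷ w) ∷ (D ∷ w) ∷ (H ∷ w) ∷ []) (words n)

dispFrom : ℕ → List Step → Bool
dispFrom zero    []      = true
dispFrom (suc h) []      = false
dispFrom h       (U ∷ w) = dispFrom (suc h) w
dispFrom zero    (D ∷ w) = false
dispFrom (suc h) (D ∷ w) = dispFrom h w
dispFrom zero    (H ∷ w) = dispFrom zero w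
dispFrom (suc h) (H ∷ w) = false

isDispersed : List Step → Bool
isDispersed = dispFrom zero

emptyOrLastH : List Step → Bool
emptyOrLastH []            = true
emptyOrLastH (U ∷ [])      = false
emptyOrLastH (D ∷ [])      = false
emptyOrLastH (H ∷ [])      = true
emptyOrLastH (_ ∷ y ∷ w)   = emptyOrLastH (y ∷ w)

startsWithU : List Step → Bool
startsWithU (U ∷ _) = true
startsWithU _       = false

valleysFrom : ℕ → List Step → ℕ
valleysFrom h       []      = zero
valleysFrom h       (U ∷ w) = valleysFrom (suc h) w
valleysFrom h       (H ∷ w) = valleysFrom h w
valleysFrom zero    (D ∷ w) = valleysFrom zero w
valleysFrom (suc h) (D ∷ w) =
  (if (h ≡ᵇ 0) ∧ startsWithU w then suc (valleysFrom h w) else valleysFrom h w)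

valleys0 : List Step → ℕ
valleys0 = valleysFrom zero

paths : ℕ → List (List Step)
paths n = filterᵇ (λ w → isDispersed w ∧ emptyOrLastH w) (words n)

v : ℕ → ℕ → ℕ
v n k = length (filterᵇ (λ w → valleys0 w ≡ᵇ k) (paths n))

sumℕ : List ℕ → ℕ
sumℕ []       = zero
sumℕ (x ∷ xs) = Data.Nat._+_ x (sumℕ xs)

sumTo : ℕ → (ℕ → ℤ) → ℤ
sumTo zero    f = f zero
sumTo (suc n) f = sumTo n f + f (suc n)

-- univariate series in z : coefficient of z^n
Ser₁ : Set
Ser₁ = ℕ → ℤ

-- bivariate series in z, t : coefficient of z^n t^k
Ser₂ : Set
Ser₂ = ℕ → ℕ → ℤ

_≈₁_ : Ser₁ → Ser₁ → Set
a ≈₁ b = ∀ n → a n ≡ b n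

_≈₂_ : Ser₂ → Ser₂ → Set
a ≈₂ b = ∀ n k → a n k ≡ b n k

infix 4 _≈₁_ _≈₂_
infixl 6 _+₁_ _-₁_ _+₂_ _-₂_
infixl 7 _*₁_ _*₂_

_+₁_ _-₁_ _*₁_ : Ser₁ → Ser₁ → Ser₁
(a +₁ b) n = a n + b n
(a -₁ b) n = a n - b n
(a *₁ b) n = sumTo n (λ i → a i * b (n ∸ i))

_+₂_ _-₂_ _*₂_ : Ser₂ → Ser₂ → Ser₂
(a +₂ b) n k = a n k + b n k
(a -₂ b) n k = a n k - b n k
(a *₂ b) n k = sumTo n (λ i → sumTo k (λ j → a i j * b (n ∸ i) (k ∸ j)))

const₁ : ℤ → Ser₁
const₁ c zero    = c
const₁ c (suc n) = + 0

z₁ : Ser₁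
z₁ (suc zero) = + 1
z₁ _          = + 0

lift : Ser₁ → Ser₂
lift a n zero    = a n
lift a n (suc k) = + 0

t₂ : Ser₂
t₂ zero (suc zero) = + 1
t₂ _    _          = + 0

one₂ z₂ : Ser₂
one₂ = lift (const₁ (+ 1))
z₂   = lift z₁

f₀ : Ser₂
f₀ n k = + (v n k)

f₀-at-t0 : Ser₁
f₀-at-t0 n = + (v n 0)

-- ∂f₀/∂t at t = 1 : coefficient of z^n is Σ_paths (number of level-0 valleys)
∂f₀-at-t1 : Ser₁
∂f₀-at-t1 n = + (sumℕ (map valleys0 (paths n)))

den₁ : Ser₁ → Ser₂
den₁ r₂ = one₂ -₂ z₂ -₂ z₂ *₂ z₂ *₂ t₂
          +₂ z₂ *₂ z₂ *₂ z₂ *₂ (t₂ -₂ one₂)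
          +₂ z₂ *₂ (z₂ -₂ one₂) *₂ lift r₂

{-# OPTIONS --safe #-}
-- Read a path with an automaton whose states are "on the axis" (remembering whether the last step
-- was a D, after which a U closes a level-0 valley) and "at height h + 1". Let A, B and C h be the
-- generating functions (z marking length, t marking level-0 valleys) of the path suffixes accepted
-- from the axis at the start or after an H, from the axis right after a D, and from height h + 1.
-- Reading the first step gives
--   A = 1 + z (C 0 + A),   B = z (t C 0 + A),   C h = z (C (h - 1) + C (h + 1)),  C (-1) = B.
-- The last system determines every C h coefficientwise, and since r₂ = z (1 + r₂²) it is solved by
-- C h = r₂^(h+1) B; in particular C 0 = r₂ B. Eliminating B and C 0 leaves (1 - z) A = 1 + z² f₁,
-- and A = f₀. The same equations at t = 0, and their t-derivatives at t = 1 (weighting a path by its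
-- number of valleys), give the two univariate identities.
module Submission where

open import Defs
open import Algebra.Bundles using (CommutativeRing)
open import Algebra.Solver.Ring.AlmostCommutativeRing using (_-Raw-AlmostCommutative⟶_; fromCommutativeRing)
open import Data.Integer using (+_) renaming (_+_ to _ℤ+_; _*_ to _ℤ*_)
import Data.Integer.Properties as ℤ
open import Data.Nat using (ℕ; zero; suc; _∸_)
open import Data.Product using (_×_; _,_)
import Relation.Binary.PropositionalEquality as ≡
open ≡ using (_≡_)

-- The summation Σ n f = f 0 + ⋯ + f n is a parameter so that the product is definitionally `_*₁_`
-- (Σ = sumTo) and, for series with coefficients in Ser₁, `_*₂_`.
module PowerSeries {c ℓ} (R : CommutativeRing c ℓ)
    (Σ : ℕ → (ℕ → CommutativeRing.Carrier R) → CommutativeRing.Carrier R)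
    (Σ-zero : ∀ f → CommutativeRing._≈_ R (Σ 0 f) (f 0))
    (Σ-suc : ∀ n f → CommutativeRing._≈_ R (Σ (suc n) f) (CommutativeRing._+_ R (Σ n f) (f (suc n))))
    where

  open import Data.Nat using (_≤_; z≤n)
  open import Data.Nat.Properties using (m∸[m∸n]≡n; m≤n⇒m≤1+n; ≤-refl)
  import Relation.Binary.Reasoning.Setoid
  open CommutativeRing R hiding (zero)
  module ≈-Reasoning = Relation.Binary.Reasoning.Setoid setoid
  open import Algebra.Properties.CommutativeSemigroup +-commutativeSemigroup using (interchange)
  open import Algebra.Solver.Ring.NaturalCoefficients.Default commutativeSemiring
    using (solve; _:+_; _:*_; _:=_)

  Ser : Set c
  Ser = ℕ → Carrier

  infix 4 _≋_
  _≋_ : Ser → Ser → Set ℓ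
  a ≋ b = ∀ n → a n ≈ b n

  infixl 6 _⊕_
  infixl 7 _⊛_
  _⊕_ _⊛_ : Ser → Ser → Ser
  (a ⊕ b) n = a n + b n
  (a ⊛ b) n = Σ n (λ i → a i * b (n ∸ i))

  ⊝_ : Ser → Ser
  (⊝ a) n = - a n

  K : Carrier → Ser
  K x zero    = x
  K x (suc n) = 0#

  𝟘 𝟙 X : Ser
  𝟘 n = 0#
  𝟙   = K 1#
  X (suc zero) = 1#
  X _          = 0#

  shift : Ser → Ser
  shift a n = a (suc n)

  Σ-cong : ∀ n {f g} → (∀ i → i ≤ n → f i ≈ g i) → Σ n f ≈ Σ n g
  Σ-cong zero    {f} {g} f≈g = trans (Σ-zero f) (trans (f≈g 0 z≤n) (sym (Σ-zero g)))
  Σ-cong (suc n) {f} {g} f≈g = begin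
    Σ (suc n) f        ≈⟨ Σ-suc n f ⟩
    Σ n f + f (suc n)  ≈⟨ +-cong (Σ-cong n λ i i≤n → f≈g i (m≤n⇒m≤1+n i≤n)) (f≈g (suc n) ≤-refl) ⟩
    Σ n g + g (suc n)  ≈⟨ Σ-suc n g ⟨
    Σ (suc n) g        ∎
    where open ≈-Reasoning

  Σ-cong′ : ∀ n {f g} → (∀ i → f i ≈ g i) → Σ n f ≈ Σ n g
  Σ-cong′ n f≈g = Σ-cong n (λ i _ → f≈g i)

  Σ-distrib-+ : ∀ n f g → Σ n (λ i → f i + g i) ≈ Σ n f + Σ n g
  Σ-distrib-+ zero    f g = trans (Σ-zero _) (sym (+-cong (Σ-zero f) (Σ-zero g)))
  Σ-distrib-+ (suc n) f g = begin
    Σ (suc n) (λ i → f i + g i)                       ≈⟨ Σ-suc n _ ⟩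
    Σ n (λ i → f i + g i) + (f (suc n) + g (suc n))   ≈⟨ +-congʳ (Σ-distrib-+ n f g) ⟩
    (Σ n f + Σ n g) + (f (suc n) + g (suc n))         ≈⟨ interchange _ _ _ _ ⟩
    (Σ n f + f (suc n)) + (Σ n g + g (suc n))         ≈⟨ +-cong (Σ-suc n f) (Σ-suc n g) ⟨
    Σ (suc n) f + Σ (suc n) g                         ∎
    where open ≈-Reasoning

  Σ-*ˡ : ∀ n x f → Σ n (λ i → x * f i) ≈ x * Σ n f
  Σ-*ˡ zero    x f = trans (Σ-zero _) (*-congˡ (sym (Σ-zero f)))
  Σ-*ˡ (suc n) x f = begin
    Σ (suc n) (λ i → x * f i)            ≈⟨ Σ-suc n _ ⟩
    Σ n (λ i → x * f i) + x * f (suc n)  ≈⟨ +-congʳ (Σ-*ˡ n x f) ⟩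
    x * Σ n f + x * f (suc n)            ≈⟨ distribˡ x _ _ ⟨
    x * (Σ n f + f (suc n))              ≈⟨ *-congˡ (Σ-suc n f) ⟨
    x * Σ (suc n) f                      ∎
    where open ≈-Reasoning

  Σ-≈0 : ∀ n f → (∀ i → f i ≈ 0#) → Σ n f ≈ 0#
  Σ-≈0 zero    f f≈0 = trans (Σ-zero f) (f≈0 0)
  Σ-≈0 (suc n) f f≈0 = trans (Σ-suc n f) (trans (+-cong (Σ-≈0 n f f≈0) (f≈0 (suc n))) (+-identityˡ 0#))

  Σ-head : ∀ n f → Σ (suc n) f ≈ f 0 + Σ n (λ i → f (suc i))
  Σ-head zero    f = trans (Σ-suc 0 f) (+-cong (Σ-zero f) (sym (Σ-zero _)))
  Σ-head (suc n) f = begin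
    Σ (suc (suc n)) f                                ≈⟨ Σ-suc (suc n) f ⟩
    Σ (suc n) f + f (suc (suc n))                    ≈⟨ +-congʳ (Σ-head n f) ⟩
    (f 0 + Σ n (λ i → f (suc i))) + f (suc (suc n))  ≈⟨ +-assoc _ _ _ ⟩
    f 0 + (Σ n (λ i → f (suc i)) + f (suc (suc n)))  ≈⟨ +-congˡ (Σ-suc n _) ⟨
    f 0 + Σ (suc n) (λ i → f (suc i))                ∎
    where open ≈-Reasoning

  Σ-reverse : ∀ n f → Σ n f ≈ Σ n (λ i → f (n ∸ i))
  Σ-reverse zero    f = trans (Σ-zero f) (sym (Σ-zero _))
  Σ-reverse (suc n) f = begin
    Σ (suc n) f                             ≈⟨ Σ-suc n f ⟩
    Σ n f + f (suc n)                       ≈⟨ +-comm _ _ ⟩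
    f (suc n) + Σ n f                       ≈⟨ +-congˡ (Σ-reverse n f) ⟩
    f (suc n) + Σ n (λ i → f (n ∸ i))       ≈⟨ Σ-head n _ ⟨
    Σ (suc n) (λ i → f (suc n ∸ i))         ∎
    where open ≈-Reasoning

  ⊛-cong : ∀ {a a′ b b′} → a ≋ a′ → b ≋ b′ → a ⊛ b ≋ a′ ⊛ b′
  ⊛-cong a≋a′ b≋b′ n = Σ-cong′ n (λ i → *-cong (a≋a′ i) (b≋b′ (n ∸ i)))

  ⊛-comm : ∀ a b → a ⊛ b ≋ b ⊛ a
  ⊛-comm a b n = trans (Σ-reverse n _) (Σ-cong n λ i i≤n →
    trans (*-comm _ _) (*-congʳ (reflexive (≡.cong b (m∸[m∸n]≡n i≤n)))))

  ⊛-distribˡ : ∀ a b d → a ⊛ (b ⊕ d) ≋ a ⊛ b ⊕ a ⊛ d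
  ⊛-distribˡ a b d n = trans (Σ-cong′ n (λ i → distribˡ _ _ _)) (Σ-distrib-+ n _ _)

  ⊛-distribʳ : ∀ a b d → (b ⊕ d) ⊛ a ≋ b ⊛ a ⊕ d ⊛ a
  ⊛-distribʳ a b d n = trans (Σ-cong′ n (λ i → distribʳ _ _ _)) (Σ-distrib-+ n _ _)

  K-⊛ : ∀ x a n → (K x ⊛ a) n ≈ x * a n
  K-⊛ x a zero    = Σ-zero _
  K-⊛ x a (suc n) = trans (Σ-head n _) (trans (+-congˡ (Σ-≈0 n _ (λ i → zeroˡ _))) (+-identityʳ _))

  ⊛-identityˡ : ∀ a → 𝟙 ⊛ a ≋ a
  ⊛-identityˡ a n = trans (K-⊛ 1# a n) (*-identityˡ _)

  ⊛-identityʳ : ∀ a → a ⊛ 𝟙 ≋ a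
  ⊛-identityʳ a n = trans (⊛-comm a 𝟙 n) (⊛-identityˡ a n)

  X⊛-zero : ∀ a → (X ⊛ a) 0 ≈ 0#
  X⊛-zero a = trans (Σ-zero _) (zeroˡ _)

  X⊛-suc : ∀ a n → (X ⊛ a) (suc n) ≈ a n
  X⊛-suc a n = trans (Σ-head n _) (trans (+-cong (zeroˡ _) (Σ-cong′ n (λ i → *-congʳ (shift-X i))))
                                         (trans (+-identityˡ _) (⊛-identityˡ a n)))
    where
    shift-X : shift X ≋ 𝟙
    shift-X zero    = refl
    shift-X (suc i) = refl

  ⊛-suc : ∀ a b n → (a ⊛ b) (suc n) ≈ a 0 * b (suc n) + (shift a ⊛ b) n
  ⊛-suc a b n = Σ-head n _

  ⊛-assoc : ∀ a b d → (a ⊛ b) ⊛ d ≋ a ⊛ (b ⊛ d)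
  ⊛-assoc a b d n = assoc n a
    where
    open ≈-Reasoning

    scale : Carrier → Ser → Ser
    scale x a n = x * a n

    scale-⊛ : ∀ x a n → (scale x a ⊛ d) n ≈ x * (a ⊛ d) n
    scale-⊛ x a n = trans (Σ-cong′ n (λ i → *-assoc _ _ _)) (Σ-*ˡ n x _)

    shift-⊛ : ∀ a → shift (a ⊛ b) ≋ scale (a 0) (shift b) ⊕ shift a ⊛ b
    shift-⊛ a = ⊛-suc a b

    assoc : ∀ n a → ((a ⊛ b) ⊛ d) n ≈ (a ⊛ (b ⊛ d)) n
    assoc zero    a = trans (Σ-zero _) (trans (*-congʳ (Σ-zero _))
                        (trans (*-assoc _ _ _) (trans (*-congˡ (sym (Σ-zero _))) (sym (Σ-zero _)))))
    assoc (suc n) a = begin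
      ((a ⊛ b) ⊛ d) (suc n)
        ≈⟨ ⊛-suc (a ⊛ b) d n ⟩
      (a ⊛ b) 0 * d (suc n) + (shift (a ⊛ b) ⊛ d) n
        ≈⟨ +-cong (*-congʳ (Σ-zero _)) (⊛-cong {b = d} (shift-⊛ a) (λ _ → refl) n) ⟩
      a 0 * b 0 * d (suc n) + ((scale (a 0) (shift b) ⊕ shift a ⊛ b) ⊛ d) n
        ≈⟨ +-congˡ (⊛-distribʳ d _ _ n) ⟩
      a 0 * b 0 * d (suc n) + ((scale (a 0) (shift b) ⊛ d) n + ((shift a ⊛ b) ⊛ d) n)
        ≈⟨ +-congˡ (+-cong (scale-⊛ (a 0) (shift b) n) (assoc n (shift a))) ⟩
      a 0 * b 0 * d (suc n) + (a 0 * (shift b ⊛ d) n + (shift a ⊛ (b ⊛ d)) n)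
        ≈⟨ solve 5 (λ x y u v w → x :* y :* u :+ (x :* v :+ w) := x :* (y :* u :+ v) :+ w)
             refl (a 0) (b 0) (d (suc n)) ((shift b ⊛ d) n) ((shift a ⊛ (b ⊛ d)) n) ⟩
      a 0 * (b 0 * d (suc n) + (shift b ⊛ d) n) + (shift a ⊛ (b ⊛ d)) n
        ≈⟨ +-congʳ (*-congˡ (⊛-suc b d n)) ⟨
      a 0 * (b ⊛ d) (suc n) + (shift a ⊛ (b ⊛ d)) n
        ≈⟨ ⊛-suc a (b ⊛ d) n ⟨
      (a ⊛ (b ⊛ d)) (suc n) ∎

  ≋-refl : ∀ {a} → a ≋ a
  ≋-refl n = refl

  serRing : CommutativeRing c ℓ
  serRing = record
    { Carrier = Ser ; _≈_ = _≋_ ; _+_ = _⊕_ ; _*_ = _⊛_ ; -_ = ⊝_ ; 0# = 𝟘 ; 1# = 𝟙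
    ; isCommutativeRing = record
      { isRing = record
        { +-isAbelianGroup = record
          { isGroup = record
            { isMonoid = record
              { isSemigroup = record
                { isMagma = record
                  { isEquivalence = record
                    { refl = ≋-refl ; sym = λ p n → sym (p n) ; trans = λ p q n → trans (p n) (q n) }
                  ; ∙-cong = λ p q n → +-cong (p n) (q n) }
                ; assoc = λ a b d n → +-assoc _ _ _ }
              ; identity = (λ a n → +-identityˡ _) , (λ a n → +-identityʳ _) }
            ; inverse = (λ a n → -‿inverseˡ _) , (λ a n → -‿inverseʳ _)
            ; ⁻¹-cong = λ p n → -‿cong (p n) }
          ; comm = λ a b n → +-comm _ _ }
        ; *-cong = ⊛-cong
        ; *-assoc = ⊛-assoc
        ; *-identity = ⊛-identityˡ , ⊛-identityʳ
        ; distrib = ⊛-distribˡ , ⊛-distribʳ }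
      ; *-comm = ⊛-comm } }

  module ≋-Reasoning = Relation.Binary.Reasoning.Setoid (CommutativeRing.setoid serRing)

  X⊛-char : ∀ {q w} → q 0 ≈ 0# → (∀ n → q (suc n) ≈ w n) → q ≋ X ⊛ w
  X⊛-char {w = w} q₀ q₊ zero    = trans q₀ (sym (X⊛-zero w))
  X⊛-char {w = w} q₀ q₊ (suc n) = trans (q₊ n) (sym (X⊛-suc w n))

  𝟙⊕X⊛-char : ∀ {q w} → q 0 ≈ 1# → (∀ n → q (suc n) ≈ w n) → q ≋ 𝟙 ⊕ X ⊛ w
  𝟙⊕X⊛-char {w = w} q₀ q₊ zero    = trans q₀ (sym (trans (+-congˡ (X⊛-zero w)) (+-identityʳ 1#)))
  𝟙⊕X⊛-char {w = w} q₀ q₊ (suc n) = trans (q₊ n) (sym (trans (+-congˡ (X⊛-suc w n)) (+-identityˡ _)))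

  X⊛-cancel : ∀ {y} → X ⊛ y ≋ 𝟘 → y ≋ 𝟘
  X⊛-cancel {y} X⊛y≋𝟘 n = trans (sym (X⊛-suc y n)) (X⊛y≋𝟘 (suc n))

  -- below C B h is C (h - 1), with B in the role of C (-1).
  below : (ℕ → Ser) → Ser → ℕ → Ser
  below C B zero    = B
  below C B (suc h) = C h

  SolvesHeightSystem : Ser → (ℕ → Ser) → Set ℓ
  SolvesHeightSystem B C = ∀ h → C h ≋ X ⊛ (below C B h ⊕ C (suc h))

  heightSystem-unique : ∀ {B C E} → SolvesHeightSystem B C → SolvesHeightSystem B E → ∀ h → C h ≋ E h
  heightSystem-unique {B} {C} {E} solC solE h n = coeff n h
    where
    open ≈-Reasoning

    initial : ∀ {F} → SolvesHeightSystem B F → ∀ h → F h 0 ≈ 0#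
    initial {F} solF h = trans (solF h 0) (X⊛-zero (below F B h ⊕ F (suc h)))

    step : ∀ {F} → SolvesHeightSystem B F → ∀ h n → F h (suc n) ≈ below F B h n + F (suc h) n
    step {F} solF h n = trans (solF h (suc n)) (X⊛-suc (below F B h ⊕ F (suc h)) n)

    coeff : ∀ n h → C h n ≈ E h n
    coeff zero    h = trans (initial solC h) (sym (initial solE h))
    coeff (suc n) h = begin
      C h (suc n)                  ≈⟨ step solC h n ⟩
      below C B h n + C (suc h) n  ≈⟨ +-cong (below-agree h) (coeff n (suc h)) ⟩
      below E B h n + E (suc h) n  ≈⟨ step solE h n ⟨
      E h (suc n)                  ∎
      where
      below-agree : ∀ h → below C B h n ≈ below E B h n
      below-agree zero    = refl
      below-agree (suc h) = coeff n h

  catalan-step : ∀ {r} → r ≋ X ⊛ (𝟙 ⊕ r ⊛ r) → ∀ p → r ⊛ p ≋ X ⊛ (p ⊕ r ⊛ (r ⊛ p))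
  catalan-step {r} r-eq p = begin
    r ⊛ p
      ≈⟨ ⊛-cong r-eq (≋-refl {p}) ⟩
    (X ⊛ (𝟙 ⊕ r ⊛ r)) ⊛ p
      ≈⟨ ⊛-assoc X _ p ⟩
    X ⊛ ((𝟙 ⊕ r ⊛ r) ⊛ p)
      ≈⟨ ⊛-cong ≋-refl (⊛-distribʳ p 𝟙 (r ⊛ r)) ⟩
    X ⊛ (𝟙 ⊛ p ⊕ (r ⊛ r) ⊛ p)
      ≈⟨ ⊛-cong ≋-refl (λ n → +-cong (⊛-identityˡ p n) (⊛-assoc r r p n)) ⟩
    X ⊛ (p ⊕ r ⊛ (r ⊛ p)) ∎
    where open ≋-Reasoning

  geometric : Ser → Ser → ℕ → Ser
  geometric r B zero    = r ⊛ B
  geometric r B (suc h) = r ⊛ geometric r B h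

  geometric-solves : ∀ {r} → r ≋ X ⊛ (𝟙 ⊕ r ⊛ r) → ∀ B → SolvesHeightSystem B (geometric r B)
  geometric-solves r-eq B zero    = catalan-step r-eq B
  geometric-solves r-eq B (suc h) = catalan-step r-eq (geometric _ B h)

module Identities {c ℓ} (R : CommutativeRing c ℓ)
    (ℤ⟶R : CommutativeRing.rawRing ℤ.+-*-commutativeRing -Raw-AlmostCommutative⟶ fromCommutativeRing R) where

  open import Data.Integer using (_≟_)
  open import Data.Maybe using (Maybe; just; nothing)
  open import Level using (_⊔_)
  open import Relation.Nullary using (yes; no)

  open CommutativeRing R hiding (zero)
  open _-Raw-AlmostCommutative⟶_ ℤ⟶R

  private
    dec : ∀ x y → Maybe (⟦ x ⟧ ≈ ⟦ y ⟧)
    dec x y with x ≟ y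
    ... | yes ≡.refl = just refl
    ... | no _       = nothing

  open import Algebra.Solver.Ring (CommutativeRing.rawRing ℤ.+-*-commutativeRing) (fromCommutativeRing R) ℤ⟶R dec
    using (solve; _:=_; _:+_; _:*_; _:-_; :-_; con)

  NonZeroDivisor : Carrier → Set (c ⊔ ℓ)
  NonZeroDivisor x = ∀ y → x * y ≈ 0# → y ≈ 0#

  -- Every identity below is a linear combination of its hypotheses lᵢ ≈ rᵢ: the solver checks
  -- L ≈ R + Σ kᵢ * (lᵢ - rᵢ), and drop-residual removes the summands one hypothesis at a time.
  drop-residual : ∀ {L R k l r} → L ≈ R + k * (l - r) → l ≈ r → L ≈ R
  drop-residual {L} {R} {k} {l} {r} L≈ l≈r =
    trans L≈ (trans (+-congˡ (trans (*-congˡ (trans (+-congʳ l≈r) (-‿inverseʳ r))) (zeroʳ k))) (+-identityʳ R))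

  ≈0⇒≈⟦0⟧ : ∀ {x} → x ≈ 0# → x ≈ ⟦ + 0 ⟧
  ≈0⇒≈⟦0⟧ x≈0 = trans x≈0 (sym 0-homo)

  -- Squaring 2zr = 1 - s and substituting s² leaves 4z (z (1 + r²) - r) = 0.
  catalan-equation : ∀ s r z → s * s ≈ ⟦ + 1 ⟧ - ⟦ + 4 ⟧ * z * z → ⟦ + 2 ⟧ * z * r ≈ ⟦ + 1 ⟧ - s →
    NonZeroDivisor z → NonZeroDivisor ⟦ + 4 ⟧ → r ≈ z * (⟦ + 1 ⟧ + r * r)
  catalan-equation s r z s² 2zr z-nzd 4-nzd = drop-residual
    (solve 2 (λ r z →
      r := z :* (con (+ 1) :+ r :* r) :+ (:- con (+ 1)) :* ((z :* (con (+ 1) :+ r :* r) :- r) :- con (+ 0))) refl r z)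
    (≈0⇒≈⟦0⟧ (4-nzd _ (z-nzd _ (trans 4z·residual 0-homo))))
    where
    4z·residual : z * (⟦ + 4 ⟧ * (z * (⟦ + 1 ⟧ + r * r) - r)) ≈ ⟦ + 0 ⟧
    4z·residual = drop-residual (drop-residual (solve 3 (λ s r z →
      z :* (con (+ 4) :* (z :* (con (+ 1) :+ r :* r) :- r))
      := con (+ 0) :+ con (+ 1) :* (s :* s :- (con (+ 1) :- con (+ 4) :* z :* z))
         :+ (con (+ 2) :* z :* r :- con (+ 1) :- s) :* (con (+ 2) :* z :* r :- (con (+ 1) :- s))) refl s r z) 2zr) s²

  denominator : Carrier → Carrier → Carrier → Carrier
  denominator z t r = ⟦ + 1 ⟧ - z - z * z * t + z * z * z * (t - ⟦ + 1 ⟧) + z * (z - ⟦ + 1 ⟧) * r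

  module ValleySystem (A B C r z t f : Carrier)
      (A-eq : A ≈ ⟦ + 1 ⟧ + z * (C + A))
      (B-eq : B ≈ z * (t * C + A))
      (C-eq : C ≈ r * B)
      (r-eq : r ≈ z * (⟦ + 1 ⟧ + r * r))
      (f-eq : f * denominator z t r ≈ z)
      (z-nzd : NonZeroDivisor z) where

    private
      den δ gap : Carrier
      den = denominator z t r
      δ   = (⟦ + 1 ⟧ - z * t * r) * (⟦ + 1 ⟧ - z) - z * z * r
      gap = z * r * B - z * z * f

    A-via-B : (⟦ + 1 ⟧ - z) * A ≈ ⟦ + 1 ⟧ + z * r * B
    A-via-B = drop-residual (drop-residual (solve 5 (λ A B C r z →
      (con (+ 1) :- z) :* A
      := con (+ 1) :+ z :* r :* B :+ con (+ 1) :* (A :- (con (+ 1) :+ z :* (C :+ A)))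
         :+ z :* (C :- r :* B)) refl A B C r z) C-eq) A-eq

    B·δ≈z : B * δ ≈ z
    B·δ≈z = drop-residual (drop-residual (drop-residual (solve 6 (λ A B C r z t →
      B :* ((con (+ 1) :- z :* t :* r) :* (con (+ 1) :- z) :- z :* z :* r)
      := z :+ z :* ((con (+ 1) :- z) :* A :- (con (+ 1) :+ z :* r :* B))
         :+ (con (+ 1) :- z) :* (B :- z :* (t :* C :+ A))
         :+ (con (+ 1) :- z) :* z :* t :* (C :- r :* B)) refl A B C r z t) C-eq) B-eq) A-via-B

    r·den≈z·δ : r * den ≈ z * δ
    r·den≈z·δ = drop-residual (solve 3 (λ r z t →
      r :* (con (+ 1) :- z :- z :* z :* t :+ z :* z :* z :* (t :- con (+ 1)) :+ z :* (z :- con (+ 1)) :* r)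
      := z :* ((con (+ 1) :- z :* t :* r) :* (con (+ 1) :- z) :- z :* z :* r)
         :+ (con (+ 1) :- z) :* (r :- z :* (con (+ 1) :+ r :* r))) refl r z t) r-eq

    -- z r B · den = z² (B δ) = z³ = z² f · den, so gap · den ≈ 0; multiplying by f and
    -- using f · den ≈ z turns this into z · gap ≈ 0.
    gap·den≈0 : gap * den ≈ ⟦ + 0 ⟧
    gap·den≈0 = drop-residual (drop-residual (drop-residual (solve 7 (λ B r z t f δ den →
      (z :* r :* B :- z :* z :* f) :* den
      := con (+ 0) :+ z :* z :* (B :* δ :- z) :+ z :* B :* (r :* den :- z :* δ)
         :+ (:- (z :* z)) :* (f :* den :- z)) refl B r z t f δ den) f-eq) r·den≈z·δ) B·δ≈z

    z·gap≈0 : z * gap ≈ 0#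
    z·gap≈0 = trans (drop-residual (drop-residual (solve 4 (λ f z den g →
      z :* g := con (+ 0) :+ f :* (g :* den :- con (+ 0)) :+ (:- g) :* (f :* den :- z)) refl f z den gap)
      f-eq) gap·den≈0) 0-homo

    one-minus-z-times-A : (⟦ + 1 ⟧ - z) * A ≈ ⟦ + 1 ⟧ + z * z * f
    one-minus-z-times-A = drop-residual (drop-residual (solve 5 (λ A B r z f →
      (con (+ 1) :- z) :* A
      := con (+ 1) :+ z :* z :* f :+ con (+ 1) :* ((con (+ 1) :- z) :* A :- (con (+ 1) :+ z :* r :* B))
         :+ con (+ 1) :* ((z :* r :* B :- z :* z :* f) :- con (+ 0))) refl A B r z f)
      (≈0⇒≈⟦0⟧ (z-nzd gap z·gap≈0))) A-via-B

  valley-free-identity : ∀ a b c c₊ r z s →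
    a ≈ ⟦ + 1 ⟧ + z * (c + a) → b ≈ z * (c₊ + a) → c₊ ≈ 0# → c ≈ r * b →
    ⟦ + 2 ⟧ * z * r ≈ ⟦ + 1 ⟧ - s →
    a * (⟦ + 2 ⟧ - ⟦ + 3 ⟧ * z + z * s) ≈ ⟦ + 2 ⟧
  valley-free-identity a b c c₊ r z s a-eq b-eq c₊≈0 c-eq 2zr =
    drop-residual (drop-residual (drop-residual (drop-residual (drop-residual (solve 7 (λ a b c c₊ r z s →
      a :* (con (+ 2) :- con (+ 3) :* z :+ z :* s)
      := con (+ 2) :+ con (+ 2) :* (a :- (con (+ 1) :+ z :* (c :+ a))) :+ con (+ 2) :* z :* (c :- r :* b)
         :+ con (+ 2) :* z :* r :* (b :- z :* (c₊ :+ a)) :+ con (+ 2) :* z :* z :* r :* (c₊ :- con (+ 0))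
         :+ a :* z :* (con (+ 2) :* z :* r :- (con (+ 1) :- s))) refl a b c c₊ r z s)
      2zr) (≈0⇒≈⟦0⟧ c₊≈0)) b-eq) c-eq) a-eq

  -- Unprimed: the system at t = 1; primed: its t-derivative at t = 1.
  module ValleyCountSystem (a₁ b₁ c₁ a′ b′ c′ r z s : Carrier)
      (a₁-eq : a₁ ≈ ⟦ + 1 ⟧ + z * (c₁ + a₁))
      (b₁-eq : b₁ ≈ z * (c₁ + a₁))
      (c₁-eq : c₁ ≈ r * b₁)
      (a′-eq : a′ ≈ ⟦ + 0 ⟧ + z * (c′ + a′))
      (b′-eq : b′ ≈ z * (c′ + c₁ + a′))
      (c′-eq : c′ ≈ r * b′)
      (r-eq : r ≈ z * (⟦ + 1 ⟧ + r * r))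
      (2zr : ⟦ + 2 ⟧ * z * r ≈ ⟦ + 1 ⟧ - s) where

    b₁-closed : b₁ * (⟦ + 1 ⟧ - z * r - z) ≈ z
    b₁-closed = drop-residual (drop-residual (drop-residual (solve 5 (λ a₁ b₁ c₁ r z →
      b₁ :* (con (+ 1) :- z :* r :- z)
      := z :+ z :* (a₁ :- (con (+ 1) :+ z :* (c₁ :+ a₁)))
         :+ (con (+ 1) :- z) :* (b₁ :- z :* (c₁ :+ a₁)) :+ z :* (c₁ :- r :* b₁)) refl a₁ b₁ c₁ r z)
      c₁-eq) b₁-eq) a₁-eq

    a′-via-b₁ : a′ * (⟦ + 1 ⟧ - z - z * r) ≈ z * r * z * r * b₁
    a′-via-b₁ = drop-residual (drop-residual (drop-residual (drop-residual (solve 7 (λ b₁ c₁ a′ b′ c′ r z →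
      a′ :* (con (+ 1) :- z :- z :* r)
      := z :* r :* z :* r :* b₁
         :+ (con (+ 1) :- z :* r) :* (a′ :- (con (+ 0) :+ z :* (c′ :+ a′)))
         :+ (z :* (con (+ 1) :- z :* r) :+ z :* r :* z) :* (c′ :- r :* b′)
         :+ z :* r :* (b′ :- z :* (c′ :+ c₁ :+ a′))
         :+ z :* r :* z :* (c₁ :- r :* b₁)) refl b₁ c₁ a′ b′ c′ r z)
      c₁-eq) b′-eq) c′-eq) a′-eq

    a′-closed : a′ * (⟦ + 1 ⟧ - ⟦ + 2 ⟧ * z) * z ≈ z * z * z * r * r * r
    a′-closed = drop-residual (drop-residual (drop-residual (solve 4 (λ b₁ a′ r z →
      a′ :* (con (+ 1) :- con (+ 2) :* z) :* z
      := z :* z :* z :* r :* r :* r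
         :+ z :* z :* r :* r :* r :* (b₁ :* (con (+ 1) :- z :* r :- z) :- z)
         :+ r :* (con (+ 1) :- z :- z :* r) :* (a′ :* (con (+ 1) :- z :- z :* r) :- z :* r :* z :* r :* b₁)
         :+ (a′ :* r :* z :- a′ :* (con (+ 1) :- con (+ 2) :* z)) :* (r :- z :* (con (+ 1) :+ r :* r)))
      refl b₁ a′ r z) r-eq) a′-via-b₁) b₁-closed

    valley-count-identity : a′ * (⟦ + 2 ⟧ * z * (⟦ + 1 ⟧ - ⟦ + 2 ⟧ * z))
                          ≈ ⟦ + 1 ⟧ - ⟦ + 3 ⟧ * z * z + (z * z - ⟦ + 1 ⟧) * s
    valley-count-identity = drop-residual (drop-residual (drop-residual (solve 4 (λ a′ r z s →
      a′ :* (con (+ 2) :* z :* (con (+ 1) :- con (+ 2) :* z))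
      := con (+ 1) :- con (+ 3) :* z :* z :+ (z :* z :- con (+ 1)) :* s
         :+ con (+ 2) :* (a′ :* (con (+ 1) :- con (+ 2) :* z) :* z :- z :* z :* z :* r :* r :* r)
         :+ (:- (con (+ 2) :* (z :+ z :* z :* r))) :* (r :- z :* (con (+ 1) :+ r :* r))
         :+ (:- (z :* z :- con (+ 1))) :* (con (+ 2) :* z :* r :- (con (+ 1) :- s))) refl a′ r z s)
      2zr) r-eq) a′-closed

module SumOver where

  open import Algebra.Properties.CommutativeSemigroup using (interchange)
  open import Data.Bool using (Bool; true; false; if_then_else_)
  open import Data.List using (List; []; _∷_; map; length; filterᵇ)
  open import Data.Nat using (_+_)
  open import Data.Nat.Properties using (+-commutativeSemigroup)
  open ≡

  sumOver : {A : Set} → (A → ℕ) → List A → ℕ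
  sumOver F xs = sumℕ (map F xs)

  sumOver-cong : {A : Set} {F G : A → ℕ} → (∀ x → F x ≡ G x) → ∀ xs → sumOver F xs ≡ sumOver G xs
  sumOver-cong F≡G []       = refl
  sumOver-cong F≡G (x ∷ xs) = cong₂ _+_ (F≡G x) (sumOver-cong F≡G xs)

  sumOver-+ : {A : Set} (F G : A → ℕ) → ∀ xs → sumOver (λ x → F x + G x) xs ≡ sumOver F xs + sumOver G xs
  sumOver-+ F G []       = refl
  sumOver-+ F G (x ∷ xs) =
    trans (cong (λ rest → F x + G x + rest) (sumOver-+ F G xs)) (interchange +-commutativeSemigroup (F x) (G x) _ _)

  sumOver-zero : {A : Set} {F : A → ℕ} → (∀ x → F x ≡ 0) → ∀ xs → sumOver F xs ≡ 0
  sumOver-zero F≡0 []       = refl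
  sumOver-zero F≡0 (x ∷ xs) = cong₂ _+_ (F≡0 x) (sumOver-zero F≡0 xs)

  sumOver-filterᵇ : {A : Set} (p : A → Bool) (F : A → ℕ) →
    ∀ xs → sumOver F (filterᵇ p xs) ≡ sumOver (λ x → if p x then F x else 0) xs
  sumOver-filterᵇ p F []       = refl
  sumOver-filterᵇ p F (x ∷ xs) with p x
  ... | true  = cong (λ rest → F x + rest) (sumOver-filterᵇ p F xs)
  ... | false = sumOver-filterᵇ p F xs

  length-filterᵇ : {A : Set} (p : A → Bool) →
    ∀ xs → length (filterᵇ p xs) ≡ sumOver (λ x → if p x then 1 else 0) xs
  length-filterᵇ p []       = refl
  length-filterᵇ p (x ∷ xs) with p x
  ... | true  = cong suc (length-filterᵇ p xs)
  ... | false = length-filterᵇ p xs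

module PathAutomaton where

  open import Data.Bool using (Bool; true; false; _∧_; if_then_else_)
  open import Data.List using (List; []; _∷_; map; concatMap)
  open import Data.Maybe using (Maybe; just; nothing)
  import Data.Maybe as Maybe
  open import Data.Nat using (_+_; _≡ᵇ_)
  open import Data.Nat.Properties using (+-comm; +-identityʳ)
  open import Data.Nat.Tactic.RingSolver using (solve-∀)
  open ≡
  open ≡-Reasoning
  open SumOver

  -- axis settled: on the x-axis, where settled = false right after a D (the next U closes a
  -- level-0 valley and the path may not stop); above h: at height h + 1.
  data State : Set where
    axis  : Bool → State
    above : ℕ → State

  -- just v: the rest of the path is accepted from the state and closes v level-0 valleys.
  run : State → List Step → Maybe ℕ
  run (axis settled)  []      = if settled then just 0 else nothing
  run (above h)       []      = nothing
  run (axis true)     (U ∷ w) = run (above 0) w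
  run (axis false)    (U ∷ w) = Maybe.map suc (run (above 0) w)
  run (axis _)        (D ∷ w) = nothing
  run (axis _)        (H ∷ w) = run (axis true) w
  run (above h)       (U ∷ w) = run (above (suc h)) w
  run (above zero)    (D ∷ w) = run (axis false) w
  run (above (suc h)) (D ∷ w) = run (above h) w
  run (above h)       (H ∷ w) = nothing

  isH : Step → Bool
  isH H = true
  isH _ = false

  lastIsHOr : Bool → List Step → Bool
  lastIsHOr b []      = b
  lastIsHOr b (x ∷ w) = lastIsHOr (isH x) w

  emptyOrLastH-∷ : ∀ x w → emptyOrLastH (x ∷ w) ≡ lastIsHOr (isH x) w
  emptyOrLastH-∷ U []      = refl
  emptyOrLastH-∷ D []      = refl
  emptyOrLastH-∷ H []      = refl
  emptyOrLastH-∷ U (y ∷ w) = emptyOrLastH-∷ y w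
  emptyOrLastH-∷ D (y ∷ w) = emptyOrLastH-∷ y w
  emptyOrLastH-∷ H (y ∷ w) = emptyOrLastH-∷ y w

  emptyOrLastH≡lastIsHOr-true : ∀ w → emptyOrLastH w ≡ lastIsHOr true w
  emptyOrLastH≡lastIsHOr-true []      = refl
  emptyOrLastH≡lastIsHOr-true (x ∷ w) = emptyOrLastH-∷ x w

  valleysAfter : Bool → List Step → ℕ
  valleysAfter true  w = valleysFrom 0 w
  valleysAfter false w = if startsWithU w then suc (valleysFrom 0 w) else valleysFrom 0 w

  runSpec : State → List Step → Maybe ℕ
  runSpec (axis settled) w = if dispFrom 0 w ∧ lastIsHOr settled w then just (valleysAfter settled w) else nothing
  runSpec (above h)      w = if dispFrom (suc h) w ∧ lastIsHOr false w then just (valleysFrom (suc h) w) else nothing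

  map-suc-if : ∀ b (m : ℕ) → Maybe.map suc (if b then just m else nothing) ≡ (if b then just (suc m) else nothing)
  map-suc-if true  m = refl
  map-suc-if false m = refl

  run-correct : ∀ σ w → run σ w ≡ runSpec σ w
  run-correct (axis true)     []      = refl
  run-correct (axis false)    []      = refl
  run-correct (above h)       []      = refl
  run-correct (axis true)     (U ∷ w) = run-correct (above 0) w
  run-correct (axis false)    (U ∷ w) = trans (cong (Maybe.map suc) (run-correct (above 0) w)) (map-suc-if _ _)
  run-correct (axis true)     (D ∷ w) = refl
  run-correct (axis false)    (D ∷ w) = refl
  run-correct (axis true)     (H ∷ w) = run-correct (axis true) w
  run-correct (axis false)    (H ∷ w) = run-correct (axis true) w
  run-correct (above h)       (U ∷ w) = run-correct (above (suc h)) w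
  run-correct (above zero)    (D ∷ w) = run-correct (axis false) w
  run-correct (above (suc h)) (D ∷ w) = run-correct (above h) w
  run-correct (above h)       (H ∷ w) = refl

  sumOver-words-suc : ∀ n F → sumOver F (words (suc n))
    ≡ sumOver (λ w → F (U ∷ w)) (words n)
      + (sumOver (λ w → F (D ∷ w)) (words n) + sumOver (λ w → F (H ∷ w)) (words n))
  sumOver-words-suc n F = extend (words n)
    where
    extend : ∀ ws → sumOver F (concatMap (λ w → (U ∷ w) ∷ (D ∷ w) ∷ (H ∷ w) ∷ []) ws)
      ≡ sumOver (λ w → F (U ∷ w)) ws + (sumOver (λ w → F (D ∷ w)) ws + sumOver (λ w → F (H ∷ w)) ws)
    extend []       = refl
    extend (w ∷ ws) = trans (cong (λ rest → F (U ∷ w) + (F (D ∷ w) + (F (H ∷ w) + rest))) (extend ws))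
                            (regroup (F (U ∷ w)) (F (D ∷ w)) (F (H ∷ w)) _ _ _)
      where
      regroup : ∀ u d h su sd sh → u + (d + (h + (su + (sd + sh)))) ≡ u + su + (d + sd + (h + sh))
      regroup = solve-∀

  count : (Maybe ℕ → ℕ) → State → ℕ → ℕ
  count G σ n = sumOver (λ w → G (run σ w)) (words n)

  stateBelow : ℕ → State
  stateBelow zero    = axis false
  stateBelow (suc h) = above h

  module _ (G : Maybe ℕ → ℕ) (G-reject : G nothing ≡ 0) where

    private
      rejected : ∀ n → sumOver (λ _ → G nothing) (words n) ≡ 0
      rejected n = sumOver-zero (λ _ → G-reject) (words n)

    count-axis-true-suc : ∀ n → count G (axis true) (suc n) ≡ count G (above 0) n + count G (axis true) n
    count-axis-true-suc n = begin
      count G (axis true) (suc n)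
        ≡⟨ sumOver-words-suc n _ ⟩
      count G (above 0) n + (sumOver (λ _ → G nothing) (words n) + count G (axis true) n)
        ≡⟨ cong (λ e → count G (above 0) n + (e + count G (axis true) n)) (rejected n) ⟩
      count G (above 0) n + count G (axis true) n ∎

    count-axis-false-suc : ∀ n →
      count G (axis false) (suc n) ≡ count (λ x → G (Maybe.map suc x)) (above 0) n + count G (axis true) n
    count-axis-false-suc n = trans (sumOver-words-suc n _)
      (cong (λ e → count (λ x → G (Maybe.map suc x)) (above 0) n + (e + count G (axis true) n)) (rejected n))

    count-above-zero : ∀ h → count G (above h) 0 ≡ 0
    count-above-zero h = cong (λ g → g + 0) G-reject

    count-above-suc : ∀ h n → count G (above h) (suc n) ≡ count G (stateBelow h) n + count G (above (suc h)) n
    count-above-suc h n = begin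
      count G (above h) (suc n)
        ≡⟨ sumOver-words-suc n _ ⟩
      count G (above (suc h)) n
        + (sumOver (λ w → G (run (above h) (D ∷ w))) (words n) + sumOver (λ _ → G nothing) (words n))
        ≡⟨ cong₂ (λ d e → count G (above (suc h)) n + (d + e))
                 (sumOver-cong (λ w → cong G (D-step h w)) (words n)) (rejected n) ⟩
      count G (above (suc h)) n + (count G (stateBelow h) n + 0)
        ≡⟨ cong (λ e → count G (above (suc h)) n + e) (+-identityʳ _) ⟩
      count G (above (suc h)) n + count G (stateBelow h) n
        ≡⟨ +-comm (count G (above (suc h)) n) _ ⟩
      count G (stateBelow h) n + count G (above (suc h)) n ∎
      where
      D-step : ∀ h w → run (above h) (D ∷ w) ≡ run (stateBelow h) w
      D-step zero    w = refl
      D-step (suc h) w = refl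

    sumOver-paths≡count : ∀ n → sumOver (λ w → G (just (valleys0 w))) (paths n) ≡ count G (axis true) n
    sumOver-paths≡count n = begin
      sumOver (λ w → G (just (valleys0 w))) (paths n)
        ≡⟨ sumOver-filterᵇ _ _ (words n) ⟩
      sumOver (λ w → if isDispersed w ∧ emptyOrLastH w then G (just (valleys0 w)) else 0) (words n)
        ≡⟨ sumOver-cong weight-via-run (words n) ⟩
      count G (axis true) n ∎
      where
      G-if : ∀ b m → (if b then G (just m) else 0) ≡ G (if b then just m else nothing)
      G-if true  m = refl
      G-if false m = sym G-reject

      weight-via-run : ∀ w → (if isDispersed w ∧ emptyOrLastH w then G (just (valleys0 w)) else 0) ≡ G (run (axis true) w)
      weight-via-run w = begin
        (if dispFrom 0 w ∧ emptyOrLastH w then G (just (valleys0 w)) else 0)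
          ≡⟨ cong (λ e → if dispFrom 0 w ∧ e then G (just (valleys0 w)) else 0) (emptyOrLastH≡lastIsHOr-true w) ⟩
        (if dispFrom 0 w ∧ lastIsHOr true w then G (just (valleys0 w)) else 0)
          ≡⟨ G-if _ _ ⟩
        G (runSpec (axis true) w)
          ≡⟨ cong G (run-correct (axis true) w) ⟨
        G (run (axis true) w) ∎

  hasValleys : ℕ → Maybe ℕ → ℕ
  hasValleys k nothing  = 0
  hasValleys k (just m) = if m ≡ᵇ k then 1 else 0

  accepted : Maybe ℕ → ℕ
  accepted nothing  = 0
  accepted (just _) = 1

  valleyCount : Maybe ℕ → ℕ
  valleyCount nothing  = 0
  valleyCount (just m) = m

  hasValleys-zero-map-suc : ∀ x → hasValleys 0 (Maybe.map suc x) ≡ 0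
  hasValleys-zero-map-suc nothing  = refl
  hasValleys-zero-map-suc (just m) = refl

  hasValleys-suc-map-suc : ∀ k x → hasValleys (suc k) (Maybe.map suc x) ≡ hasValleys k x
  hasValleys-suc-map-suc k nothing  = refl
  hasValleys-suc-map-suc k (just m) = refl

  accepted-map-suc : ∀ x → accepted (Maybe.map suc x) ≡ accepted x
  accepted-map-suc nothing  = refl
  accepted-map-suc (just m) = refl

  valleyCount-map-suc : ∀ x → valleyCount (Maybe.map suc x) ≡ valleyCount x + accepted x
  valleyCount-map-suc nothing  = refl
  valleyCount-map-suc (just m) = +-comm 1 m

  v≡count : ∀ n k → v n k ≡ count (hasValleys k) (axis true) n
  v≡count n k = trans (length-filterᵇ _ (paths n)) (sumOver-paths≡count (hasValleys k) refl n)

  valleySum≡count : ∀ n → sumℕ (map valleys0 (paths n)) ≡ count valleyCount (axis true) n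
  valleySum≡count n = sumOver-paths≡count valleyCount refl n

open import Data.Bool using (true; false)
open import Data.Maybe using (Maybe; just; nothing)
import Data.Maybe as Maybe
open import Data.Nat using (_+_)
open SumOver using (sumOver-cong; sumOver-+; sumOver-zero)
open import Data.Nat.Properties using (+-identityʳ)

module S₁ = PowerSeries ℤ.+-*-commutativeRing sumTo (λ _ → ≡.refl) (λ _ _ → ≡.refl)

sumTo₁ : ℕ → (ℕ → Ser₁) → Ser₁
sumTo₁ n f k = sumTo n (λ i → f i k)

module S₂ = PowerSeries S₁.serRing sumTo₁ (λ _ _ → ≡.refl) (λ _ _ _ → ≡.refl)

module R₁ = CommutativeRing S₁.serRing
module R₂ = CommutativeRing S₂.serRing

CatalanEquation : Ser₁ → Set
CatalanEquation r = r ≈₁ z₁ *₁ (const₁ (+ 1) +₁ r *₁ r)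

const₁≈₁K : ∀ c → const₁ c ≈₁ S₁.K c
const₁≈₁K c zero    = ≡.refl
const₁≈₁K c (suc n) = ≡.refl

ℤ⟶Ser₁ : CommutativeRing.rawRing ℤ.+-*-commutativeRing -Raw-AlmostCommutative⟶ fromCommutativeRing S₁.serRing
ℤ⟶Ser₁ = record
  { ⟦_⟧    = const₁
  ; +-homo = λ { x y zero → ≡.refl ; x y (suc n) → ≡.refl }
  ; *-homo = λ x y n → R₁.sym (R₁.trans (S₁.⊛-cong (const₁≈₁K x) (const₁≈₁K y)) (K-* x y)) n
  ; -‿homo = λ { x zero → ≡.refl ; x (suc n) → ≡.refl }
  ; 0-homo = λ { zero → ≡.refl ; (suc n) → ≡.refl }
  ; 1-homo = λ { zero → ≡.refl ; (suc n) → ≡.refl }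
  }
  where
  K-* : ∀ x y → S₁.K x *₁ S₁.K y ≈₁ const₁ (x ℤ* y)
  K-* x y zero    = S₁.K-⊛ x (S₁.K y) zero
  K-* x y (suc n) = ≡.trans (S₁.K-⊛ x (S₁.K y) (suc n)) (ℤ.*-zeroʳ x)

lift-cong : ∀ {a b} → a ≈₁ b → lift a ≈₂ lift b
lift-cong a≈b n zero    = a≈b n
lift-cong a≈b n (suc k) = ≡.refl

lift-+ : ∀ a b → lift (a +₁ b) ≈₂ lift a +₂ lift b
lift-+ a b n zero    = ≡.refl
lift-+ a b n (suc k) = ≡.refl

lift-* : ∀ a b → lift (a *₁ b) ≈₂ lift a *₂ lift b
lift-* a b n zero    = ≡.refl
lift-* a b n (suc k) = ≡.sym (S₁.Σ-≈0 n _ (λ i → S₁.Σ-≈0 (suc k) _ (vanishes i)))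
  where
  vanishes : ∀ i j → lift a i j ℤ* lift b (n ∸ i) (suc k ∸ j) ≡ + 0
  vanishes i zero    = ℤ.*-zeroʳ (a i)
  vanishes i (suc j) = ℤ.*-zeroˡ (lift b (n ∸ i) (k ∸ j))

ℤ⟶Ser₂ : CommutativeRing.rawRing ℤ.+-*-commutativeRing -Raw-AlmostCommutative⟶ fromCommutativeRing S₂.serRing
ℤ⟶Ser₂ = record
  { ⟦_⟧    = λ c → lift (const₁ c)
  ; +-homo = λ x y → R₂.trans (lift-cong (+-homo x y)) (lift-+ _ _)
  ; *-homo = λ x y → R₂.trans (lift-cong (*-homo x y)) (lift-* _ _)
  ; -‿homo = λ x → R₂.trans (lift-cong (-‿homo x)) (λ { n zero → ≡.refl ; n (suc k) → ≡.refl })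
  ; 0-homo = λ { zero zero → ≡.refl ; zero (suc k) → ≡.refl ; (suc n) zero → ≡.refl ; (suc n) (suc k) → ≡.refl }
  ; 1-homo = λ { zero zero → ≡.refl ; zero (suc k) → ≡.refl ; (suc n) zero → ≡.refl ; (suc n) (suc k) → ≡.refl }
  }
  where open _-Raw-AlmostCommutative⟶_ ℤ⟶Ser₁

module I₁ = Identities S₁.serRing ℤ⟶Ser₁
module I₂ = Identities S₂.serRing ℤ⟶Ser₂

z₁≈₁X : z₁ ≈₁ S₁.X
z₁≈₁X zero          = ≡.refl
z₁≈₁X (suc zero)    = ≡.refl
z₁≈₁X (suc (suc n)) = ≡.refl

z₂≈₂X : z₂ ≈₂ S₂.X
z₂≈₂X zero          zero    = ≡.refl
z₂≈₂X zero          (suc k) = ≡.refl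
z₂≈₂X (suc zero)    zero    = ≡.refl
z₂≈₂X (suc zero)    (suc k) = ≡.refl
z₂≈₂X (suc (suc n)) zero    = ≡.refl
z₂≈₂X (suc (suc n)) (suc k) = ≡.refl

t₂≈₂K : t₂ ≈₂ S₂.K z₁
t₂≈₂K zero    zero          = ≡.refl
t₂≈₂K zero    (suc zero)    = ≡.refl
t₂≈₂K zero    (suc (suc k)) = ≡.refl
t₂≈₂K (suc n) k             = ≡.refl

z₁*-zero : ∀ w → (z₁ *₁ w) 0 ≡ + 0
z₁*-zero w = ≡.trans (S₁.⊛-cong z₁≈₁X (R₁.refl {w}) 0) (S₁.X⊛-zero w)

z₁*-suc : ∀ w n → (z₁ *₁ w) (suc n) ≡ w n
z₁*-suc w n = ≡.trans (S₁.⊛-cong z₁≈₁X (R₁.refl {w}) (suc n)) (S₁.X⊛-suc w n)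

z₁*-char : ∀ {q w} → q 0 ≡ + 0 → (∀ n → q (suc n) ≡ w n) → q ≈₁ z₁ *₁ w
z₁*-char {w = w} q₀ q₊ = R₁.trans (S₁.X⊛-char q₀ q₊) (R₁.*-congʳ {w} (R₁.sym z₁≈₁X))

const₁+z₁*-char : ∀ {c q w} → q 0 ≡ c → (∀ n → q (suc n) ≡ w n) → q ≈₁ const₁ c +₁ z₁ *₁ w
const₁+z₁*-char {c} {w = w} q₀ q₊ zero =
  ≡.trans q₀ (≡.sym (≡.trans (≡.cong (c ℤ+_) (z₁*-zero w)) (ℤ.+-identityʳ c)))
const₁+z₁*-char {w = w} q₀ q₊ (suc n) =
  ≡.trans (q₊ n) (≡.sym (≡.trans (≡.cong (+ 0 ℤ+_) (z₁*-suc w n)) (ℤ.+-identityˡ _)))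

z₂*-char : ∀ {q w} → q 0 ≈₁ S₁.𝟘 → (∀ n → q (suc n) ≈₁ w n) → q ≈₂ z₂ *₂ w
z₂*-char {w = w} q₀ q₊ = R₂.trans (S₂.X⊛-char q₀ q₊) (R₂.*-congʳ {w} (R₂.sym z₂≈₂X))

one₂+z₂*-char : ∀ {q w} → q 0 ≈₁ S₁.𝟙 → (∀ n → q (suc n) ≈₁ w n) → q ≈₂ one₂ +₂ z₂ *₂ w
one₂+z₂*-char {w = w} q₀ q₊ =
  R₂.trans (S₂.𝟙⊕X⊛-char q₀ q₊) (R₂.+-cong (R₂.sym 1-homo) (R₂.*-congʳ {w} (R₂.sym z₂≈₂X)))
  where open _-Raw-AlmostCommutative⟶_ ℤ⟶Ser₂

z₁-nonZeroDivisor : I₁.NonZeroDivisor z₁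
z₁-nonZeroDivisor y z₁y≈0 = S₁.X⊛-cancel (R₁.trans (R₁.*-congʳ {y} (R₁.sym z₁≈₁X)) z₁y≈0)

z₂-nonZeroDivisor : I₂.NonZeroDivisor z₂
z₂-nonZeroDivisor y z₂y≈0 = S₂.X⊛-cancel (R₂.trans (R₂.*-congʳ {y} (R₂.sym z₂≈₂X)) z₂y≈0)

4-nonZeroDivisor : I₁.NonZeroDivisor (const₁ (+ 4))
4-nonZeroDivisor y 4y≈0 n = ℤ.*-cancelˡ-≡ (+ 4) (y n) (+ 0) (≡.trans (≡.sym 4y≡4*y) (4y≈0 n))
  where
  4y≡4*y : (const₁ (+ 4) *₁ y) n ≡ + 4 ℤ* y n
  4y≡4*y = ≡.trans (S₁.⊛-cong (const₁≈₁K (+ 4)) (R₁.refl {y}) n) (S₁.K-⊛ (+ 4) y n)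

t₂*-zero : ∀ w n → (t₂ *₂ w) n 0 ≡ + 0
t₂*-zero w n =
  ≡.trans (S₂.⊛-cong t₂≈₂K (R₂.refl {w}) n 0) (≡.trans (S₂.K-⊛ z₁ w n 0) (z₁*-zero (w n)))

t₂*-suc : ∀ w n k → (t₂ *₂ w) n (suc k) ≡ w n k
t₂*-suc w n k =
  ≡.trans (S₂.⊛-cong t₂≈₂K (R₂.refl {w}) n (suc k)) (≡.trans (S₂.K-⊛ z₁ w n (suc k)) (z₁*-suc (w n) k))

catalan-X₁ : ∀ {r} → CatalanEquation r → r ≈₁ S₁.X *₁ (S₁.𝟙 +₁ r *₁ r)
catalan-X₁ {r} r-eq = R₁.trans r-eq (R₁.*-cong z₁≈₁X (R₁.+-congʳ {r *₁ r} 1-homo))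
  where open _-Raw-AlmostCommutative⟶_ ℤ⟶Ser₁

catalan-X₂ : ∀ {r} → r ≈₂ z₂ *₂ (one₂ +₂ r *₂ r) → r ≈₂ S₂.X *₂ (S₂.𝟙 +₂ r *₂ r)
catalan-X₂ {r} r-eq = R₂.trans r-eq (R₂.*-cong z₂≈₂X (R₂.+-congʳ {r *₂ r} 1-homo))
  where open _-Raw-AlmostCommutative⟶_ ℤ⟶Ser₂

catalan-lift : ∀ {r} → CatalanEquation r → lift r ≈₂ z₂ *₂ (one₂ +₂ lift r *₂ lift r)
catalan-lift {r} r-eq = R₂.trans (lift-cong r-eq) (R₂.trans (lift-* z₁ _)
  (R₂.*-congˡ {z₂} (R₂.trans (lift-+ (const₁ (+ 1)) (r *₁ r)) (R₂.+-congˡ {one₂} (lift-* r r)))))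

open PathAutomaton

gf : (Maybe ℕ → ℕ) → State → Ser₁
gf G σ n = + count G σ n

gf-cong : ∀ {G G′} → (∀ x → G x ≡ G′ x) → ∀ σ → gf G σ ≈₁ gf G′ σ
gf-cong G≡G′ σ n = ≡.cong +_ (sumOver-cong (λ w → G≡G′ (run σ w)) (words n))

gf-+ : ∀ G G′ σ → gf (λ x → G x + G′ x) σ ≈₁ gf G σ +₁ gf G′ σ
gf-+ G G′ σ n = ≡.cong +_ (sumOver-+ _ _ (words n))

module _ (G : Maybe ℕ → ℕ) (G-reject : G nothing ≡ 0) where

  gf-axis-true : gf G (axis true) ≈₁ const₁ (+ G (just 0)) +₁ z₁ *₁ (gf G (above 0) +₁ gf G (axis true))
  gf-axis-true = const₁+z₁*-char (≡.cong +_ (+-identityʳ _)) (λ n → ≡.cong +_ (count-axis-true-suc G G-reject n))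

  gf-axis-false : gf G (axis false) ≈₁ z₁ *₁ (gf (λ x → G (Maybe.map suc x)) (above 0) +₁ gf G (axis true))
  gf-axis-false = z₁*-char (≡.cong (λ g → + (g + 0)) G-reject) (λ n → ≡.cong +_ (count-axis-false-suc G G-reject n))

  gf-above-initial : ∀ h → gf G (above h) 0 ≡ + 0
  gf-above-initial h = ≡.cong +_ (count-above-zero G G-reject h)

  gf-above-step : ∀ h n → gf G (above h) (suc n) ≡ gf G (stateBelow h) n ℤ+ gf G (above (suc h)) n
  gf-above-step h n = ≡.cong +_ (count-above-suc G G-reject h n)

  gf-heightSystem : S₁.SolvesHeightSystem (gf G (axis false)) (λ h → gf G (above h))
  gf-heightSystem zero    = S₁.X⊛-char (gf-above-initial 0) (gf-above-step 0)
  gf-heightSystem (suc h) = S₁.X⊛-char (gf-above-initial (suc h)) (gf-above-step (suc h))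

  gf-above-0 : ∀ {r} → CatalanEquation r → gf G (above 0) ≈₁ r *₁ gf G (axis false)
  gf-above-0 r-eq = S₁.heightSystem-unique gf-heightSystem (S₁.geometric-solves (catalan-X₁ r-eq) _) 0

gf-hasValleys-zero-map-suc : ∀ σ → gf (λ x → hasValleys 0 (Maybe.map suc x)) σ ≈₁ S₁.𝟘
gf-hasValleys-zero-map-suc σ n = ≡.cong +_ (sumOver-zero (λ w → hasValleys-zero-map-suc (run σ w)) (words n))

gf₂ : State → Ser₂
gf₂ σ n k = gf (hasValleys k) σ n

gf₂-axis-true : gf₂ (axis true) ≈₂ one₂ +₂ z₂ *₂ (gf₂ (above 0) +₂ gf₂ (axis true))
gf₂-axis-true = one₂+z₂*-char initial (λ n k → ≡.cong +_ (count-axis-true-suc (hasValleys k) ≡.refl n))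
  where
  initial : gf₂ (axis true) 0 ≈₁ S₁.𝟙
  initial zero    = ≡.refl
  initial (suc k) = ≡.refl

gf₂-axis-false : gf₂ (axis false) ≈₂ z₂ *₂ (t₂ *₂ gf₂ (above 0) +₂ gf₂ (axis true))
gf₂-axis-false = z₂*-char (λ k → ≡.refl) λ n k →
  ≡.trans (≡.cong +_ (count-axis-false-suc (hasValleys k) ≡.refl n)) (≡.cong (_ℤ+ gf₂ (axis true) n k) (closing n k))
  where
  closing : ∀ n k → gf (λ x → hasValleys k (Maybe.map suc x)) (above 0) n ≡ (t₂ *₂ gf₂ (above 0)) n k
  closing n zero    = ≡.trans (gf-hasValleys-zero-map-suc (above 0) n) (≡.sym (t₂*-zero (gf₂ (above 0)) n))
  closing n (suc k) = ≡.trans (gf-cong (hasValleys-suc-map-suc k) (above 0) n) (≡.sym (t₂*-suc (gf₂ (above 0)) n k))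

gf₂-heightSystem : S₂.SolvesHeightSystem (gf₂ (axis false)) (λ h → gf₂ (above h))
gf₂-heightSystem zero    = S₂.X⊛-char (λ k → gf-above-initial (hasValleys k) ≡.refl 0)
                                      (λ n k → gf-above-step (hasValleys k) ≡.refl 0 n)
gf₂-heightSystem (suc h) = S₂.X⊛-char (λ k → gf-above-initial (hasValleys k) ≡.refl (suc h))
                                      (λ n k → gf-above-step (hasValleys k) ≡.refl (suc h) n)

f₀≈₂gf₂ : f₀ ≈₂ gf₂ (axis true)
f₀≈₂gf₂ n k = ≡.cong +_ (v≡count n k)

f₀-at-t0≈₁gf : f₀-at-t0 ≈₁ gf (hasValleys 0) (axis true)
f₀-at-t0≈₁gf n = ≡.cong +_ (v≡count n 0)

∂f₀-at-t1≈₁gf : ∂f₀-at-t1 ≈₁ gf valleyCount (axis true)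
∂f₀-at-t1≈₁gf n = ≡.cong +_ (valleySum≡count n)

f₀-identity : ∀ {r f} → CatalanEquation r → f *₂ den₁ r ≈₂ z₂ →
  (one₂ -₂ z₂) *₂ f₀ ≈₂ one₂ +₂ z₂ *₂ z₂ *₂ f
f₀-identity {r} {f} r-eq f-eq = R₂.trans (R₂.*-congˡ {one₂ -₂ z₂} f₀≈₂gf₂)
  (I₂.ValleySystem.one-minus-z-times-A (gf₂ (axis true)) (gf₂ (axis false)) (gf₂ (above 0)) (lift r) z₂ t₂ f
    gf₂-axis-true gf₂-axis-false C-eq (catalan-lift r-eq) f-eq z₂-nonZeroDivisor)
  where
  C-eq : gf₂ (above 0) ≈₂ lift r *₂ gf₂ (axis false)
  C-eq = S₂.heightSystem-unique gf₂-heightSystem (S₂.geometric-solves (catalan-X₂ (catalan-lift r-eq)) _) 0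

f₀-at-t0-identity : ∀ {s r} → CatalanEquation r → const₁ (+ 2) *₁ z₁ *₁ r ≈₁ const₁ (+ 1) -₁ s →
  f₀-at-t0 *₁ (const₁ (+ 2) -₁ const₁ (+ 3) *₁ z₁ +₁ z₁ *₁ s) ≈₁ const₁ (+ 2)
f₀-at-t0-identity {s} {r} r-eq 2zr =
  R₁.trans (R₁.*-congʳ {const₁ (+ 2) -₁ const₁ (+ 3) *₁ z₁ +₁ z₁ *₁ s} f₀-at-t0≈₁gf)
    (I₁.valley-free-identity (gf G (axis true)) (gf G (axis false)) (gf G (above 0))
      (gf (λ x → G (Maybe.map suc x)) (above 0)) r z₁ s
      (gf-axis-true G ≡.refl) (gf-axis-false G ≡.refl) (gf-hasValleys-zero-map-suc (above 0))
      (gf-above-0 G ≡.refl r-eq) 2zr)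
  where
  G : Maybe ℕ → ℕ
  G = hasValleys 0

∂f₀-at-t1-identity : ∀ {s r} → CatalanEquation r → const₁ (+ 2) *₁ z₁ *₁ r ≈₁ const₁ (+ 1) -₁ s →
  ∂f₀-at-t1 *₁ (const₁ (+ 2) *₁ z₁ *₁ (const₁ (+ 1) -₁ const₁ (+ 2) *₁ z₁))
    ≈₁ const₁ (+ 1) -₁ const₁ (+ 3) *₁ z₁ *₁ z₁ +₁ (z₁ *₁ z₁ -₁ const₁ (+ 1)) *₁ s
∂f₀-at-t1-identity {s} {r} r-eq 2zr =
  R₁.trans (R₁.*-congʳ {const₁ (+ 2) *₁ z₁ *₁ (const₁ (+ 1) -₁ const₁ (+ 2) *₁ z₁)} ∂f₀-at-t1≈₁gf)
    (I₁.ValleyCountSystem.valley-count-identity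
      (gf accepted (axis true)) (gf accepted (axis false)) (gf accepted (above 0))
      (gf valleyCount (axis true)) (gf valleyCount (axis false)) (gf valleyCount (above 0)) r z₁ s
      (gf-axis-true accepted ≡.refl) b₁-eq (gf-above-0 accepted ≡.refl r-eq)
      (gf-axis-true valleyCount ≡.refl) b′-eq (gf-above-0 valleyCount ≡.refl r-eq) r-eq 2zr)
  where
  b₁-eq : gf accepted (axis false) ≈₁ z₁ *₁ (gf accepted (above 0) +₁ gf accepted (axis true))
  b₁-eq = R₁.trans (gf-axis-false accepted ≡.refl)
    (R₁.*-congˡ {z₁} (R₁.+-congʳ {gf accepted (axis true)} (gf-cong accepted-map-suc (above 0))))

  b′-eq : gf valleyCount (axis false)
        ≈₁ z₁ *₁ (gf valleyCount (above 0) +₁ gf accepted (above 0) +₁ gf valleyCount (axis true))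
  b′-eq = R₁.trans (gf-axis-false valleyCount ≡.refl)
    (R₁.*-congˡ {z₁} (R₁.+-congʳ {gf valleyCount (axis true)}
      (R₁.trans (gf-cong valleyCount-map-suc (above 0)) (gf-+ valleyCount accepted (above 0)))))

mainTheorem6 : (s r₂ : Ser₁) (f₁ : Ser₂) →
    s *₁ s ≈₁ const₁ (+ 1) -₁ const₁ (+ 4) *₁ z₁ *₁ z₁ →
    s 0 ≡ + 1 →
    const₁ (+ 2) *₁ z₁ *₁ r₂ ≈₁ const₁ (+ 1) -₁ s →
    f₁ *₂ den₁ r₂ ≈₂ z₂ →
    ((one₂ -₂ z₂) *₂ f₀ ≈₂ one₂ +₂ z₂ *₂ z₂ *₂ f₁)
    × (f₀-at-t0 *₁ (const₁ (+ 2) -₁ const₁ (+ 3) *₁ z₁ +₁ z₁ *₁ s) ≈₁ const₁ (+ 2))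
    × (∂f₀-at-t1 *₁ (const₁ (+ 2) *₁ z₁ *₁ (const₁ (+ 1) -₁ const₁ (+ 2) *₁ z₁))
        ≈₁ const₁ (+ 1) -₁ const₁ (+ 3) *₁ z₁ *₁ z₁ +₁ (z₁ *₁ z₁ -₁ const₁ (+ 1)) *₁ s)
    × (∂f₀-at-t1 0 ≡ + 0) × (∂f₀-at-t1 1 ≡ + 0) × (∂f₀-at-t1 2 ≡ + 0)
    × (∂f₀-at-t1 3 ≡ + 0) × (∂f₀-at-t1 4 ≡ + 0) × (∂f₀-at-t1 5 ≡ + 1)
    × (∂f₀-at-t1 6 ≡ + 2) × (∂f₀-at-t1 7 ≡ + 7) × (∂f₀-at-t1 8 ≡ + 14)
mainTheorem6 s r₂ f₁ s² _ 2zr f₁-eq =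
    f₀-identity {f = f₁} r-eq f₁-eq , f₀-at-t0-identity {s} r-eq 2zr , ∂f₀-at-t1-identity {s} r-eq 2zr
  , ≡.refl , ≡.refl , ≡.refl , ≡.refl , ≡.refl , ≡.refl , ≡.refl , ≡.refl , ≡.refl
  where
  r-eq : CatalanEquation r₂
  r-eq = I₁.catalan-equation s r₂ z₁ s² 2zr z₁-nonZeroDivisor 4-nonZeroDivisor
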